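{- Let $n\ge3$ and $A\in\mathscr S^*(n)$ with parameters $c=c(A)$, $v=v(A)$, $s=s(A)$, $\bar c=c(\bar A)$, $\bar v=v(\bar A)$, $\bar s=s(\bar A)$, and suppose $c+\bar c\ge n$. Then $$s+\bar s\le-\frac34(c+\bar c)^2+(n+1)(c+\bar c)-\frac14(c-\bar c)^2-v-\bar c,$$ with equality if $\bar v=n-c-1$. Moreover, $c+\bar c<\frac{4n}{3}+\frac13$.
   Context: $\mathscr S(n)$ is the set of $n\times n$ $(0,1)$-matrices with zero diagonal. $\mathscr S^*(n)$ is the set of $A=(a_{ij})\in\mathscr S(n)$ with $a_{12}=a_{21}=1$, $a_{n-1,n}=a_{n,n-1}=0$, and such that whenever $a_{ij}=1$, also $a_{hk}=1$ for all $h\le i$, $k\le j$ with $h\neq k$. For $A\in\mathscr S^*(n)$ with row sums $r_1,\dots,r_n$: $c(A)=\max\{i\in[n]: r_1+\cdots+r_i>i(i-1)\}$, $v(A)=r_{c(A)+1}$, $s(A)=\sum_{i=1}^{c(A)}r_i-c(A)(c(A)-1)$. For $A=(a_{ij})\in\mathscr S^*(n)$, $\bar A=(\bar a_{ij})$ is the $n\times n$ matrix with zero diagonal and $\bar a_{ij}=1-a_{n-j+1,n-i+1}$ for $i\neq j$; it again lies in $\mathscr S^*(n)$. -}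

module Defs where

open import Data.Bool using (Bool; true; false; not; if_then_else_)
open import Data.Nat using (ℕ; zero; suc; _+_; _*_; _∸_; _<ᵇ_; _<?_; _≤_)
open import Data.Fin using (Fin; fromℕ<; opposite; _≟_)
import Data.Fin as F
open import Data.List using (map; upTo)
open import Data.Nat.ListAction using (sum)
open import Data.Integer as ℤ using (ℤ; +_)
open import Relation.Nullary using (yes; no; ¬_)
open import Relation.Binary.PropositionalEquality using (_≡_; _≢_)

-- An n×n (0,1)-matrix, entries true = 1, false = 0, indices 0-based.
Mat : ℕ → Set
Mat n = Fin n → Fin n → Bool

-- 1-based access to entries (false = 0 outside the range 1..n).
at : ∀ {n} → Mat n → ℕ → ℕ → Bool
at {n} A (suc i) (suc j) with i <? n | j <? n
... | yes p | yes q = A (fromℕ< p) (fromℕ< q)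
... | _     | _     = false
at A _ _ = false

b2n : Bool → ℕ
b2n true = 1
b2n false = 0

record InSStar (n : ℕ) (A : Mat n) : Set where
  field
    zeroDiag : ∀ i → A i i ≡ false
    a12 : at A 1 2 ≡ true
    a21 : at A 2 1 ≡ true
    aN-1N : at A (n ∸ 1) n ≡ false
    aNN-1 : at A n (n ∸ 1) ≡ false
    downClosed : ∀ i j h k → A i j ≡ true → h F.≤ i → k F.≤ j → h ≢ k → A h k ≡ true

-- row sum r_i (1-based; 0 outside 1..n)
r : ∀ {n} → Mat n → ℕ → ℕ
r {n} A i = sum (map (λ j → b2n (at A i (suc j))) (upTo n))

R : ∀ {n} → Mat n → ℕ → ℕ
R A zero = 0
R A (suc i) = R A i + r A (suc i)

-- largest i ≤ k (i ≥ 1) with R i > i(i-1); 0 if none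
cUpTo : ∀ {n} → Mat n → ℕ → ℕ
cUpTo A zero = 0
cUpTo A (suc i) = if (suc i * i) <ᵇ R A (suc i) then suc i else cUpTo A i

c : ∀ {n} → Mat n → ℕ
c {n} A = cUpTo A n

v : ∀ {n} → Mat n → ℕ
v A = r A (suc (c A))

s : ∀ {n} → Mat n → ℤ
s A = (+ R A (c A)) ℤ.- (+ (c A * (c A ∸ 1)))

-- Ā : ā_ij = 1 - a_{n-j+1, n-i+1} for i ≠ j, zero diagonal
bar : ∀ {n} → Mat n → Mat n
bar A i j with i ≟ j
... | yes _ = false
... | no _  = not (A (opposite j) (opposite i))

module Submission where

-- Put m = n - c̄ and cut A after its first c rows and its first m columns, with top-left
-- block sum X and bottom-right block sum Y.  Since Ā is the complemented transpose of A
-- about the antidiagonal, the first c̄ rows of Ā are the last c̄ columns of A, and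
-- counting gives  s + s̄ = X - Y + m c̄ - c(c - 1).  The zero diagonal gives
-- X ≤ m(c - 1) and v = r_{c+1} ≤ m + Y, and the right-hand side of the bound exceeds
-- 4(s + s̄) by exactly four times the total slack of these two estimates.  If
-- v̄ = n - c - 1, column m of A contains exactly c ones, and down-closure makes both
-- estimates sharp.  Finally, with p = c - m and q = n - c, the identity yields
-- 1 + p² ≤ mq + p, and 4mq ≤ (m + q)² forces 2p ≤ m + q, that is 3(c + c̄) ≤ 4n.

open import Defs

module FiniteSums where
  open import Data.List using (applyUpTo)
  open import Data.Nat
  open import Data.Nat.ListAction using (sum)
  open import Data.Nat.Properties
  open import Data.Nat.Tactic.RingSolver using (solve-∀)
  open import Function using (_∘_)
  open import Relation.Binary.PropositionalEquality

  ∑< : ℕ → (ℕ → ℕ) → ℕ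
  ∑< N f = sum (applyUpTo f N)

  syntax ∑< N (λ k → e) = ∑[ k < N ] e

  private variable
    N M a b j x : ℕ
    f g : ℕ → ℕ

  ∑-cong : ∀ N → (∀ {k} → k < N → f k ≡ g k) → ∑< N f ≡ ∑< N g
  ∑-cong zero    eq = refl
  ∑-cong (suc N) eq = cong₂ _+_ (eq z<s) (∑-cong N (eq ∘ s<s))

  ∑-mono-≤ : ∀ N → (∀ {k} → k < N → f k ≤ g k) → ∑< N f ≤ ∑< N g
  ∑-mono-≤ zero    le = z≤n
  ∑-mono-≤ (suc N) le = +-mono-≤ (le z<s) (∑-mono-≤ N (le ∘ s<s))

  ∑-const : ∀ N → ∑[ _ < N ] x ≡ N * x
  ∑-const zero    = refl
  ∑-const (suc N) = cong (_ +_) (∑-const N)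

  ∑-zero : (∀ {k} → k < N → f k ≡ 0) → ∑< N f ≡ 0
  ∑-zero {N} eq = trans (∑-cong N eq) (trans (∑-const N) (*-zeroʳ N))

  ∑-ones : (∀ {k} → k < N → f k ≡ 1) → ∑< N f ≡ N
  ∑-ones {N} eq = trans (∑-cong N eq) (trans (∑-const N) (*-identityʳ N))

  ∑≤N : (∀ k → f k ≤ 1) → ∑< N f ≤ N
  ∑≤N {N = N} ≤1 = ≤-trans (∑-mono-≤ N (λ {k} _ → ≤1 k)) (≤-reflexive (∑-ones {N} λ _ → refl))

  ∑-distrib-+ : ∀ N → ∑[ k < N ] (f k + g k) ≡ ∑< N f + ∑< N g
  ∑-distrib-+ zero = refl
  ∑-distrib-+ {f} {g} (suc N) =
    trans (cong (f 0 + g 0 +_) (∑-distrib-+ N)) (+-+-swap (f 0) (g 0) _ _)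
    where
    +-+-swap : ∀ a b c d → a + b + (c + d) ≡ a + c + (b + d)
    +-+-swap = solve-∀

  ∑-split : ∀ a → ∑< (a + b) f ≡ ∑< a f + ∑[ k < b ] f (a + k)
  ∑-split zero    = refl
  ∑-split {f = f} (suc a) = trans (cong (f 0 +_) (∑-split a)) (sym (+-assoc (f 0) _ _))

  ∑-prefix-≤ : M ≤ N → ∑< M f ≤ ∑< N f
  ∑-prefix-≤ {M} {N} {f} M≤N = begin
    ∑< M f                               ≤⟨ m≤m+n _ _ ⟩
    ∑< M f + ∑[ k < N ∸ M ] f (M + k)    ≡⟨ ∑-split M ⟨
    ∑< (M + (N ∸ M)) f                   ≡⟨ cong (λ L → ∑< L f) (m+[n∸m]≡n M≤N) ⟩
    ∑< N f                               ∎
    where open ≤-Reasoning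

  ∑-tail-zero : M ≤ N → (∀ {k} → M ≤ k → f k ≡ 0) → ∑< N f ≡ ∑< M f
  ∑-tail-zero {M} {N} {f} M≤N tail≡0 = begin
    ∑< N f                               ≡⟨ cong (λ L → ∑< L f) (m+[n∸m]≡n M≤N) ⟨
    ∑< (M + (N ∸ M)) f                   ≡⟨ ∑-split M ⟩
    ∑< M f + ∑[ k < N ∸ M ] f (M + k)    ≡⟨ cong (∑< M f +_) (∑-zero {N ∸ M} (λ _ → tail≡0 (m≤m+n M _))) ⟩
    ∑< M f + 0                           ≡⟨ +-identityʳ _ ⟩
    ∑< M f                               ∎
    where open ≡-Reasoning

  ∑-single : j < N → (∀ {k} → k < N → k ≢ j → f k ≡ 0) → ∑< N f ≡ f j
  ∑-single {zero}  {suc N} {f} _ others =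
    trans (cong (f 0 +_) (∑-zero λ k<N → others (s<s k<N) λ ())) (+-identityʳ _)
  ∑-single {suc j} {suc N} (s<s j<N) others rewrite others z<s (λ ()) =
    ∑-single j<N λ k<N k≢j → others (s<s k<N) (k≢j ∘ suc-injective)

  ∑-snoc : ∀ N → ∑< (suc N) f ≡ ∑< N f + f N
  ∑-snoc zero    = +-comm _ 0
  ∑-snoc {f} (suc N) = trans (cong (f 0 +_) (∑-snoc N)) (sym (+-assoc (f 0) _ _))

  ∑-reverse : ∀ N → ∑< N f ≡ ∑[ k < N ] f (N ∸ suc k)
  ∑-reverse zero = refl
  ∑-reverse {f} (suc N) = begin
    f 0 + ∑[ k < N ] f (suc k)          ≡⟨ cong (f 0 +_) (∑-reverse N) ⟩
    f 0 + ∑[ k < N ] f (suc (N ∸ suc k)) ≡⟨ cong (f 0 +_) (∑-cong N (λ k<N → cong f (sym (+-∸-assoc 1 k<N)))) ⟩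
    f 0 + ∑[ k < N ] f (N ∸ k)          ≡⟨ +-comm (f 0) _ ⟩
    ∑[ k < N ] f (N ∸ k) + f 0          ≡⟨ cong (λ i → ∑[ k < N ] f (N ∸ k) + f i) (n∸n≡0 N) ⟨
    ∑[ k < N ] f (N ∸ k) + f (N ∸ N)    ≡⟨ ∑-snoc N ⟨
    ∑[ k < suc N ] f (suc N ∸ suc k)    ∎
    where open ≡-Reasoning

  ∑-comm : ∀ N M (h : ℕ → ℕ → ℕ) → ∑[ i < N ] ∑[ j < M ] h i j ≡ ∑[ j < M ] ∑[ i < N ] h i j
  ∑-comm zero    M h = sym (∑-zero {M} λ _ → refl)
  ∑-comm (suc N) M h =
    trans (cong (∑< M (h 0) +_) (∑-comm N M (h ∘ suc))) (sym (∑-distrib-+ M))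

  term≤∑ : j < N → f j ≤ ∑< N f
  term≤∑ {zero}  {suc N} _ = m≤m+n _ _
  term≤∑ {suc j} {suc N} {f} (s<s j<N) = ≤-trans (term≤∑ j<N) (m≤n+m _ (f 0))

  ∑-hole-< : (∀ k → f k ≤ 1) → j < N → f j ≡ 0 → ∑< N f < N
  ∑-hole-< {f} {zero} {suc N} ≤1 _ fj≡0 rewrite fj≡0 = s≤s (∑≤N (≤1 ∘ suc))
  ∑-hole-< {f} {suc j} {suc N} ≤1 (s<s j<N) fj≡0 =
    ≤-trans (≤-reflexive (sym (+-suc (f 0) _))) (+-mono-≤ (≤1 0) (∑-hole-< (≤1 ∘ suc) j<N fj≡0))

  ∑-hole : (∀ {k} → k < N → k ≢ j → f k ≡ 1) → j < N → f j ≡ 0 → suc (∑< N f) ≡ N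
  ∑-hole {suc N} {zero} {f} ones _ fj≡0 rewrite fj≡0 =
    cong suc (∑-ones λ k<N → ones (s<s k<N) λ ())
  ∑-hole {suc N} {suc j} ones (s<s j<N) fj≡0 rewrite ones z<s (λ ()) =
    cong suc (∑-hole (λ k<N k≢j → ones (s<s k<N) (k≢j ∘ suc-injective)) j<N fj≡0)

open FiniteSums

module Matrices where
  open import Data.Bool using (true; false; not; T)
  open import Data.Empty using (⊥-elim)
  open import Data.Fin as F using (Fin; fromℕ<; toℕ; opposite)
  open import Data.Fin.Properties using (toℕ-fromℕ<; fromℕ<-toℕ; toℕ<n; fromℕ<-injective; opposite-prop)
  open import Data.List.Properties using (map-applyUpTo)
  open import Data.Nat.ListAction using (sum)
  open import Data.Nat
  open import Data.Nat.Properties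
  open import Data.Nat.Tactic.RingSolver using (solve-∀)
  open import Data.Product using (_×_; _,_; proj₁; proj₂)
  open import Data.Sum using (_⊎_; inj₁; inj₂)
  open import Data.Unit using (tt)
  open import Function using (_∘_; id)
  open import Relation.Binary.PropositionalEquality
  open import Relation.Nullary using (yes; no)

  b2n≤1 : ∀ b → b2n b ≤ 1
  b2n≤1 true  = s≤s z≤n
  b2n≤1 false = z≤n

  b2n≡1⇒true : ∀ {b} → b2n b ≡ 1 → b ≡ true
  b2n≡1⇒true {true} _ = refl

  b2n-not : ∀ b → b2n (not b) + b2n b ≡ 1
  b2n-not true  = refl
  b2n-not false = refl

  -- entry A i j is a_{i+1,j+1} as a number, and 0 outside the matrix
  entry : ∀ {n} → Mat n → ℕ → ℕ → ℕ
  entry A i j = b2n (at A (suc i) (suc j))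

  rowSum : ∀ {n} → Mat n → ℕ → ℕ
  rowSum {n} A i = ∑[ j < n ] entry A i j

  colSum : ∀ {n} → Mat n → ℕ → ℕ
  colSum {n} A j = ∑[ i < n ] entry A i j

  ZeroDiagonal : ∀ {n} → Mat n → Set
  ZeroDiagonal A = ∀ i → A i i ≡ false

  module _ {n} (A : Mat n) where
    private variable
      i j h k : ℕ

    entry-fromℕ< : (i<n : i < n) (j<n : j < n) → entry A i j ≡ b2n (A (fromℕ< i<n) (fromℕ< j<n))
    entry-fromℕ< {i} {j} i<n j<n with i <? n | j <? n
    ... | yes _   | yes _   = refl
    ... | no i≮n  | _       = ⊥-elim (i≮n i<n)
    ... | yes _   | no j≮n  = ⊥-elim (j≮n j<n)

    entry-toℕ : ∀ x y → entry A (toℕ x) (toℕ y) ≡ b2n (A x y)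
    entry-toℕ x y = trans (entry-fromℕ< (toℕ<n x) (toℕ<n y)) (cong₂ (λ x y → b2n (A x y)) (fromℕ<-toℕ x _) (fromℕ<-toℕ y _))

    entry-rowOutside : n ≤ i → entry A i j ≡ 0
    entry-rowOutside {i} {j} n≤i with i <? n | j <? n
    ... | yes i<n | yes _ = ⊥-elim (<⇒≱ i<n n≤i)
    ... | yes _   | no _  = refl
    ... | no _    | _     = refl

    entry-colOutside : n ≤ j → entry A i j ≡ 0
    entry-colOutside {j = j} {i = i} n≤j with i <? n | j <? n
    ... | yes _ | yes j<n = ⊥-elim (<⇒≱ j<n n≤j)
    ... | yes _ | no _    = refl
    ... | no _  | _       = refl

    entry≤1 : ∀ i j → entry A i j ≤ 1
    entry≤1 i j = b2n≤1 _

    entry-binary : ∀ i j → entry A i j ≡ 0 ⊎ entry A i j ≡ 1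
    entry-binary i j with at A (suc i) (suc j)
    ... | false = inj₁ refl
    ... | true  = inj₂ refl

    entry≡1⇒inside : entry A i j ≡ 1 → i < n × j < n
    entry≡1⇒inside {i} {j} a≡1 =
      ≰⇒> (λ n≤i → 0≢1+n (trans (sym (entry-rowOutside {j = j} n≤i)) a≡1)) ,
      ≰⇒> (λ n≤j → 0≢1+n (trans (sym (entry-colOutside {i = i} n≤j)) a≡1))

    entry-diag : ZeroDiagonal A → ∀ i → entry A i i ≡ 0
    entry-diag zeroDiag i with n ≤? i
    ... | yes n≤i = entry-rowOutside n≤i
    ... | no n≰i  = trans (entry-fromℕ< (≰⇒> n≰i) (≰⇒> n≰i)) (cong b2n (zeroDiag _))

    entry-downClosed : InSStar n A → entry A i j ≡ 1 → h ≤ i → k ≤ j → h ≢ k → entry A h k ≡ 1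
    entry-downClosed {i} {j} {h} {k} H a≡1 h≤i k≤j h≢k =
      trans (entry-fromℕ< h<n k<n)
            (cong b2n (InSStar.downClosed H _ _ _ _ Aij≡true (toℕ-mono h≤i) (toℕ-mono k≤j) (h≢k ∘ fromℕ<-injective h k h<n k<n)))
      where
      i<n : i < n
      i<n = proj₁ (entry≡1⇒inside a≡1)
      j<n : j < n
      j<n = proj₂ (entry≡1⇒inside a≡1)
      h<n : h < n
      h<n = ≤-<-trans h≤i i<n
      k<n : k < n
      k<n = ≤-<-trans k≤j j<n
      Aij≡true : A (fromℕ< i<n) (fromℕ< j<n) ≡ true
      Aij≡true = b2n≡1⇒true (trans (sym (entry-fromℕ< i<n j<n)) a≡1)
      toℕ-mono : ∀ {x y} .{x<n : x < n} .{y<n : y < n} → x ≤ y → fromℕ< x<n F.≤ fromℕ< y<n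
      toℕ-mono x≤y = subst₂ _≤_ (sym (toℕ-fromℕ< _)) (sym (toℕ-fromℕ< _)) x≤y

    entry-upClosed : InSStar n A → entry A h k ≡ 0 → h ≢ k → h ≤ i → k ≤ j → entry A i j ≡ 0
    entry-upClosed {h} {k} {i} {j} H a≡0 h≢k h≤i k≤j with entry-binary i j
    ... | inj₁ a′≡0 = a′≡0
    ... | inj₂ a′≡1 = ⊥-elim (0≢1+n (trans (sym a≡0) (entry-downClosed H a′≡1 h≤i k≤j h≢k)))

  bar-zeroDiagonal : ∀ {n} (A : Mat n) → ZeroDiagonal (bar A)
  bar-zeroDiagonal A x with x F.≟ x
  ... | yes _  = refl
  ... | no x≢x = ⊥-elim (x≢x refl)

  bar-offDiagonal : ∀ {n} (A : Mat n) {x y} → x ≢ y → b2n (bar A x y) + b2n (A (opposite y) (opposite x)) ≡ 1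
  bar-offDiagonal A {x} {y} x≢y with x F.≟ y
  ... | yes x≡y = ⊥-elim (x≢y x≡y)
  ... | no _    = b2n-not (A (opposite y) (opposite x))

  entry-bar : ∀ {n} (A : Mat n) {i j} → i < n → j < n → i ≢ j →
              entry (bar A) i j + entry A (n ∸ suc j) (n ∸ suc i) ≡ 1
  entry-bar {n} A {i} {j} i<n j<n i≢j = begin
    entry (bar A) i j + entry A (n ∸ suc j) (n ∸ suc i)
      ≡⟨ cong₂ _+_ (entry-fromℕ< (bar A) i<n j<n) (cong₂ (entry A) (toℕ-opposite j<n) (toℕ-opposite i<n)) ⟩
    b2n (bar A x y) + entry A (toℕ (opposite y)) (toℕ (opposite x))
      ≡⟨ cong (b2n (bar A x y) +_) (entry-toℕ A _ _) ⟩
    b2n (bar A x y) + b2n (A (opposite y) (opposite x))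
      ≡⟨ bar-offDiagonal A (i≢j ∘ fromℕ<-injective i j i<n j<n) ⟩
    1 ∎
    where
    open ≡-Reasoning
    x y : Fin n
    x = fromℕ< i<n
    y = fromℕ< j<n
    toℕ-opposite : ∀ {k} (k<n : k < n) → n ∸ suc k ≡ toℕ (opposite (fromℕ< k<n))
    toℕ-opposite k<n = sym (trans (opposite-prop _) (cong (λ k → n ∸ suc k) (toℕ-fromℕ< k<n)))

  r≡rowSum : ∀ {n} (A : Mat n) i → r A (suc i) ≡ rowSum A i
  r≡rowSum {n} A i = cong sum (map-applyUpTo id _ n)

  R≡∑rowSum : ∀ {n} (A : Mat n) k → R A k ≡ ∑[ i < k ] rowSum A i
  R≡∑rowSum A zero    = refl
  R≡∑rowSum A (suc k) = trans (cong₂ _+_ (R≡∑rowSum A k) (r≡rowSum A k)) (sym (∑-snoc k))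

  rowSum-bar+colSum : ∀ {n} (A : Mat n) → ZeroDiagonal A → ∀ {i} → i < n →
                      suc (rowSum (bar A) i + colSum A (n ∸ suc i)) ≡ n
  rowSum-bar+colSum {n} A zeroDiag {i} i<n = begin
    suc (rowSum (bar A) i + colSum A (n ∸ suc i))
      ≡⟨ cong (λ s → suc (rowSum (bar A) i + s)) (∑-reverse n) ⟩
    suc (rowSum (bar A) i + ∑[ j < n ] entry A (n ∸ suc j) (n ∸ suc i))
      ≡⟨ cong suc (∑-distrib-+ n) ⟨
    suc (∑[ j < n ] (entry (bar A) i j + entry A (n ∸ suc j) (n ∸ suc i)))
      ≡⟨ ∑-hole (λ j<n j≢i → entry-bar A i<n j<n (j≢i ∘ sym)) i<n
                (cong₂ _+_ (entry-diag (bar A) (bar-zeroDiagonal A) i) (entry-diag A zeroDiag _)) ⟩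
    n ∎
    where open ≡-Reasoning

  module _ {n} {A : Mat n} (H : InSStar n A) where
    open InSStar H using (zeroDiag)

    private variable
      h j k : ℕ

    colSum≥ : entry A h j ≡ 1 → j ≤ h → h ≤ colSum A j
    colSum≥ {h} {j} a≡1 j≤h = begin
      h                          ≡⟨ suc-injective (∑-hole ones (s≤s j≤h) (entry-diag A zeroDiag j)) ⟨
      ∑[ i < suc h ] entry A i j ≤⟨ ∑-prefix-≤ (proj₁ (entry≡1⇒inside A a≡1)) ⟩
      colSum A j                 ∎
      where
      open ≤-Reasoning
      ones : ∀ {i} → i < suc h → i ≢ j → entry A i j ≡ 1
      ones i<1+h = entry-downClosed A H a≡1 (s≤s⁻¹ i<1+h) ≤-refl

    colSum< : ∀ {c j} → entry A c j ≡ 0 → j < c → c ≤ n → colSum A j < c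
    colSum< {c} {j} a≡0 j<c c≤n = begin-strict
      colSum A j             ≡⟨ ∑-tail-zero c≤n (λ c≤i → entry-upClosed A H a≡0 (>⇒≢ j<c) c≤i ≤-refl) ⟩
      ∑[ i < c ] entry A i j <⟨ ∑-hole-< (λ i → entry≤1 A i j) j<c (entry-diag A zeroDiag j) ⟩
      c                      ∎
      where open ≤-Reasoning

    module Corner {c j} (j<c : j < c) (c<n : c < n) (colSum≡c : colSum A j ≡ c) where

      corner : entry A c j ≡ 1
      corner with entry-binary A c j
      ... | inj₂ a≡1 = a≡1
      ... | inj₁ a≡0 = ⊥-elim (<-irrefl colSum≡c (colSum< a≡0 j<c (<⇒≤ c<n)))

      inside-corner : ∀ {i k} → i ≤ c → k ≤ j → i ≢ k → entry A i k ≡ 1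
      inside-corner = entry-downClosed A H corner

      below-corner : c < h → j ≤ k → entry A h k ≡ 0
      below-corner {h} c<h j≤k with entry-binary A h j
      ... | inj₁ a≡0 = entry-upClosed A H a≡0 (>⇒≢ (<-trans j<c c<h)) ≤-refl j≤k
      ... | inj₂ a≡1 = ⊥-elim (<⇒≱ c<h (subst (h ≤_) colSum≡c (colSum≥ a≡1 (<⇒≤ (<-trans j<c c<h)))))

  module Blocks {n} (A : Mat n) {c c̄ m q : ℕ} (m+c̄≡n : m + c̄ ≡ n) (c+q≡n : c + q ≡ n) where

    topLeft : ℕ
    topLeft = ∑[ i < c ] ∑[ j < m ] entry A i j

    rightPart : ℕ → ℕ
    rightPart i = ∑[ k < c̄ ] entry A i (m + k)

    bottomRight : ℕ
    bottomRight = ∑[ i < q ] rightPart (c + i)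

    rightColumns : ℕ
    rightColumns = ∑[ k < c̄ ] colSum A (m + k)

    rowSum-split : ∀ i → rowSum A i ≡ ∑[ j < m ] entry A i j + rightPart i
    rowSum-split i = trans (cong (λ N → ∑< N (entry A i)) (sym m+c̄≡n)) (∑-split m)

    prefix+bottomRight : R A c + bottomRight ≡ topLeft + rightColumns
    prefix+bottomRight = begin
      R A c + bottomRight
        ≡⟨ cong (_+ bottomRight) (trans (R≡∑rowSum A c) (trans (∑-cong c (λ _ → rowSum-split _)) (∑-distrib-+ c))) ⟩
      topLeft + ∑[ i < c ] rightPart i + bottomRight
        ≡⟨ +-assoc topLeft _ _ ⟩
      topLeft + (∑[ i < c ] rightPart i + bottomRight)
        ≡⟨ cong (topLeft +_) (∑-split c) ⟨
      topLeft + ∑[ i < c + q ] rightPart i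
        ≡⟨ cong (λ N → topLeft + ∑< N rightPart) c+q≡n ⟩
      topLeft + ∑[ i < n ] rightPart i
        ≡⟨ cong (topLeft +_) (∑-comm n c̄ _) ⟩
      topLeft + rightColumns ∎
      where open ≡-Reasoning

    -- the columns m, …, n-1 of A are the reversed rows 0, …, c̄-1 of Ā, complemented
    barPrefix+rightColumns : ZeroDiagonal A → c̄ + (R (bar A) c̄ + rightColumns) ≡ c̄ * n
    barPrefix+rightColumns zeroDiag = begin
      c̄ + (R (bar A) c̄ + rightColumns)
        ≡⟨ cong₂ (λ x y → c̄ + (x + y)) (R≡∑rowSum (bar A) c̄) (trans (∑-reverse c̄) (∑-cong c̄ (cong (colSum A) ∘ reindex))) ⟩
      c̄ + (∑[ k < c̄ ] rowSum (bar A) k + ∑[ k < c̄ ] colSum A (n ∸ suc k))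
        ≡⟨ trans (∑-distrib-+ {f = λ _ → 1} c̄) (cong₂ _+_ (∑-ones {c̄} (λ _ → refl)) (∑-distrib-+ c̄)) ⟨
      ∑[ k < c̄ ] suc (rowSum (bar A) k + colSum A (n ∸ suc k))
        ≡⟨ ∑-cong c̄ (λ k<c̄ → rowSum-bar+colSum A zeroDiag (<-≤-trans k<c̄ c̄≤n)) ⟩
      ∑[ k < c̄ ] n
        ≡⟨ ∑-const c̄ ⟩
      c̄ * n ∎
      where
      open ≡-Reasoning
      c̄≤n : c̄ ≤ n
      c̄≤n = subst (c̄ ≤_) m+c̄≡n (m≤n+m c̄ m)
      reindex : ∀ {k} → k < c̄ → m + (c̄ ∸ suc k) ≡ n ∸ suc k
      reindex k<c̄ = trans (sym (+-∸-assoc m k<c̄)) (cong (_∸ suc _) m+c̄≡n)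

    prefixSums : ZeroDiagonal A → R A c + R (bar A) c̄ + bottomRight + c̄ ≡ topLeft + c̄ * n
    prefixSums zeroDiag = +-cancelʳ-≡ rightColumns _ _ (begin
      R A c + R (bar A) c̄ + bottomRight + c̄ + rightColumns
        ≡⟨ shuffle (R A c) (R (bar A) c̄) bottomRight c̄ rightColumns ⟩
      (R A c + bottomRight) + (c̄ + (R (bar A) c̄ + rightColumns))
        ≡⟨ cong₂ _+_ prefix+bottomRight (barPrefix+rightColumns zeroDiag) ⟩
      topLeft + rightColumns + c̄ * n
        ≡⟨ right-swap topLeft rightColumns _ ⟩
      topLeft + c̄ * n + rightColumns ∎)
      where
      open ≡-Reasoning
      shuffle : ∀ a b y d e → a + b + y + d + e ≡ (a + y) + (d + (b + e))
      shuffle = solve-∀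
      right-swap : ∀ a b d → a + b + d ≡ a + d + b
      right-swap = solve-∀

    q>0 : c < n → 0 < q
    q>0 c<n = +-cancelˡ-< c 0 q (subst₂ _<_ (sym (+-identityʳ c)) (sym c+q≡n) c<n)

    topLeft≤ : ZeroDiagonal A → m ≤ c → topLeft ≤ m * (c ∸ 1)
    topLeft≤ zeroDiag m≤c = begin
      topLeft                             ≡⟨ ∑-comm c m _ ⟩
      ∑[ j < m ] ∑[ i < c ] entry A i j   ≤⟨ ∑-mono-≤ m (∸-monoˡ-≤ 1 ∘ column<c) ⟩
      ∑[ j < m ] (c ∸ 1)                  ≡⟨ ∑-const m ⟩
      m * (c ∸ 1)                         ∎
      where
      open ≤-Reasoning
      column<c : ∀ {j} → j < m → ∑[ i < c ] entry A i j < c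
      column<c {j} j<m = ∑-hole-< (λ i → entry≤1 A i j) (<-≤-trans j<m m≤c) (entry-diag A zeroDiag j)

    rightPart≤bottomRight : rightPart c ≤ bottomRight
    rightPart≤bottomRight with n ≤? c
    ... | yes n≤c = ≤-trans (≤-reflexive (∑-zero {c̄} λ _ → entry-rowOutside A n≤c)) z≤n
    ... | no n≰c  = subst (_≤ bottomRight) (cong rightPart (+-identityʳ c)) (term≤∑ (q>0 (≰⇒> n≰c)))

    rowSum≤ : rowSum A c ≤ m + bottomRight
    rowSum≤ = begin
      rowSum A c                                 ≡⟨ rowSum-split c ⟩
      ∑[ j < m ] entry A c j + rightPart c       ≤⟨ +-mono-≤ (∑≤N (entry≤1 A c)) rightPart≤bottomRight ⟩
      m + bottomRight                            ∎
      where open ≤-Reasoning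

    module EqualityCase (H : InSStar n A) (m≤c : m ≤ c) (v̄+c+1≡n : suc (rowSum (bar A) c̄ + c) ≡ n) where
      open InSStar H using (zeroDiag)

      c<n : c < n
      c<n = subst (c <_) v̄+c+1≡n (s≤s (m≤n+m c _))

      n≡1+c : m ≡ 0 → n ≡ suc c
      n≡1+c m≡0 = trans (sym v̄+c+1≡n) (cong (λ x → suc (x + c)) v̄≡0)
        where
        c̄≡n : c̄ ≡ n
        c̄≡n = trans (cong (_+ c̄) (sym m≡0)) m+c̄≡n
        v̄≡0 : rowSum (bar A) c̄ ≡ 0
        v̄≡0 = ∑-zero {n} λ _ → entry-rowOutside (bar A) (≤-reflexive (sym c̄≡n))

      colSum≡c : (m≢0 : m ≢ 0) → colSum A (pred m) ≡ c
      colSum≡c m≢0 = +-cancelˡ-≡ (rowSum (bar A) c̄) _ _ (suc-injective (begin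
        suc (rowSum (bar A) c̄ + colSum A (pred m))    ≡⟨ cong (λ k → suc (rowSum (bar A) c̄ + colSum A k)) index ⟨
        suc (rowSum (bar A) c̄ + colSum A (n ∸ suc c̄)) ≡⟨ rowSum-bar+colSum A zeroDiag c̄<n ⟩
        n                                              ≡⟨ v̄+c+1≡n ⟨
        suc (rowSum (bar A) c̄ + c)                    ∎))
        where
        open ≡-Reasoning
        n≡ : n ≡ suc (pred m + c̄)
        n≡ = trans (sym m+c̄≡n) (cong (_+ c̄) (sym (suc-pred m {{≢-nonZero m≢0}})))
        c̄<n : c̄ < n
        c̄<n = subst (c̄ <_) (sym n≡) (s≤s (m≤n+m c̄ (pred m)))
        index : n ∸ suc c̄ ≡ pred m
        index = trans (cong (_∸ suc c̄) n≡) (m+n∸n≡m (pred m) c̄)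

      module LastLeftColumn (m≢0 : m ≢ 0) =
        Corner H (≤-trans (≤-reflexive (suc-pred m {{≢-nonZero m≢0}})) m≤c) c<n (colSum≡c m≢0)

      topLeft-ones : ∀ {i k} → i ≤ c → k < m → i ≢ k → entry A i k ≡ 1
      topLeft-ones {k = k} i≤c k<m with m ≟ 0
      ... | yes m≡0 = ⊥-elim (n≮0 (subst (k <_) m≡0 k<m))
      ... | no m≢0  = LastLeftColumn.inside-corner m≢0 i≤c (<⇒≤pred k<m)

      lowerRight-zeros : ∀ {h k} → c < h → m ≤ k → entry A h k ≡ 0
      lowerRight-zeros {h} c<h m≤k with m ≟ 0
      ... | yes m≡0 = entry-rowOutside A (subst (_≤ h) (sym (n≡1+c m≡0)) c<h)
      ... | no m≢0  = LastLeftColumn.below-corner m≢0 c<h (≤-trans pred[n]≤n m≤k)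

      topLeft≡ : topLeft ≡ m * (c ∸ 1)
      topLeft≡ = begin
        topLeft                             ≡⟨ ∑-comm c m _ ⟩
        ∑[ j < m ] ∑[ i < c ] entry A i j   ≡⟨ ∑-cong m (cong (_∸ 1) ∘ column≡c) ⟩
        ∑[ j < m ] (c ∸ 1)                  ≡⟨ ∑-const m ⟩
        m * (c ∸ 1)                         ∎
        where
        open ≡-Reasoning
        column≡c : ∀ {j} → j < m → suc (∑[ i < c ] entry A i j) ≡ c
        column≡c {j} j<m =
          ∑-hole (λ i<c i≢j → topLeft-ones (<⇒≤ i<c) j<m i≢j) (<-≤-trans j<m m≤c) (entry-diag A zeroDiag j)

      bottomRight≡ : bottomRight ≡ rightPart c
      bottomRight≡ = trans (∑-single (q>0 c<n) lower≡0) (cong rightPart (+-identityʳ c))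
        where
        lower≡0 : ∀ {i} → i < q → i ≢ 0 → rightPart (c + i) ≡ 0
        lower≡0 {i} _ i≢0 = ∑-zero {c̄} λ _ → lowerRight-zeros (m<m+n c (n≢0⇒n>0 i≢0)) (m≤m+n m _)

      rowSum≡ : rowSum A c ≡ m + bottomRight
      rowSum≡ = begin
        rowSum A c                            ≡⟨ rowSum-split c ⟩
        ∑[ k < m ] entry A c k + rightPart c  ≡⟨ cong₂ _+_ (∑-ones left≡1) (sym bottomRight≡) ⟩
        m + bottomRight                       ∎
        where
        open ≡-Reasoning
        left≡1 : ∀ {k} → k < m → entry A c k ≡ 1
        left≡1 k<m = topLeft-ones ≤-refl k<m (>⇒≢ (<-≤-trans k<m m≤c))

  cUpTo≤ : ∀ {n} (A : Mat n) k → cUpTo A k ≤ k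
  cUpTo≤ A zero = z≤n
  cUpTo≤ A (suc i) with suc i * i <ᵇ R A (suc i)
  ... | true  = ≤-refl
  ... | false = m≤n⇒m≤1+n (cUpTo≤ A i)

  <ᵇ≡true⇒< : ∀ {x y} → (x <ᵇ y) ≡ true → x < y
  <ᵇ≡true⇒< {x} {y} x<ᵇy = <ᵇ⇒< x y (subst T (sym x<ᵇy) tt)

  cUpTo-prefix≥ : ∀ {n} (A : Mat n) k → cUpTo A k * (cUpTo A k ∸ 1) ≤ R A (cUpTo A k)
  cUpTo-prefix≥ A zero = z≤n
  cUpTo-prefix≥ A (suc i) with suc i * i <ᵇ R A (suc i) in test
  ... | true  = <⇒≤ (<ᵇ≡true⇒< test)
  ... | false = cUpTo-prefix≥ A i

  -- R A 1 > 1 * 0 makes i = 1 a candidate for the maximum defining cUpTo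
  cUpTo-prefix> : ∀ {n} (A : Mat n) k → 0 < R A 1 → 0 < k → cUpTo A k * (cUpTo A k ∸ 1) < R A (cUpTo A k)
  cUpTo-prefix> A (suc i) R₁>0 _ with suc i * i <ᵇ R A (suc i) in test
  cUpTo-prefix> A (suc i)       R₁>0 _ | true  = <ᵇ≡true⇒< test
  cUpTo-prefix> A (suc zero)    R₁>0 _ | false = ⊥-elim (subst T test (<⇒<ᵇ R₁>0))
  cUpTo-prefix> A (suc (suc i)) R₁>0 _ | false = cUpTo-prefix> A (suc i) R₁>0 z<s

  prefix>⇒pos : ∀ {n} (A : Mat n) {k} → k * (k ∸ 1) < R A k → 0 < k
  prefix>⇒pos A {suc k} _ = z<s

  firstRow>0 : ∀ {n} (A : Mat n) → InSStar n A → 2 ≤ n → 0 < R A 1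
  firstRow>0 A H 2≤n = begin-strict
    0              <⟨ z<s ⟩
    1              ≡⟨ cong b2n (InSStar.a12 H) ⟨
    entry A 0 1    ≤⟨ term≤∑ 2≤n ⟩
    rowSum A 0     ≡⟨ r≡rowSum A 0 ⟨
    R A 1          ∎
    where open ≤-Reasoning

open Matrices

module Arithmetic where
  open import Data.Nat
  open import Data.Nat.Properties
  open import Data.Nat.Tactic.RingSolver using (solve-∀)
  open import Data.Sum using ([_,_]′)
  open import Relation.Binary.PropositionalEquality
  open import Relation.Nullary using (¬_)

  four-mul≤square : ∀ a b → 4 * (a * b) ≤ (a + b) * (a + b)
  four-mul≤square a b = [ ordered , swapped ]′ (≤-total a b)
    where
    square-of-sum : ∀ a d → 4 * (a * (a + d)) + d * d ≡ (a + (a + d)) * (a + (a + d))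
    square-of-sum = solve-∀
    ordered : ∀ {a b} → a ≤ b → 4 * (a * b) ≤ (a + b) * (a + b)
    ordered {a} {b} a≤b = subst (λ b → 4 * (a * b) ≤ (a + b) * (a + b)) (m+[n∸m]≡n a≤b)
      (subst (4 * (a * (a + (b ∸ a))) ≤_) (square-of-sum a (b ∸ a)) (m≤m+n _ _))
    swapped : b ≤ a → 4 * (a * b) ≤ (a + b) * (a + b)
    swapped b≤a = subst₂ _≤_ (cong (4 *_) (*-comm b a)) (cong (λ x → x * x) (+-comm b a)) (ordered b≤a)

  twice≤sum : ∀ m p q → 1 + p * p ≤ m * q + p → p + p ≤ m + q
  twice≤sum m zero    q _ = z≤n
  twice≤sum m (suc p) q 1+p²≤mq+p = ≮⇒≥ m+q≮2p
    where
    open ≤-Reasoning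
    K : ℕ
    K = (p + suc p) * (p + suc p) + 4 * suc p
    expand : ∀ p → (p + suc p) * (p + suc p) + 4 * suc p + 3 ≡ 4 * (1 + suc p * suc p)
    expand = solve-∀
    m+q≮2p : ¬ (m + q < suc p + suc p)
    m+q≮2p (s≤s m+q≤2p+1) = m+1+n≰m K (begin
      K + 3                                    ≡⟨ expand p ⟩
      4 * (1 + suc p * suc p)                  ≤⟨ *-monoʳ-≤ 4 1+p²≤mq+p ⟩
      4 * (m * q + suc p)                      ≡⟨ *-distribˡ-+ 4 (m * q) _ ⟩
      4 * (m * q) + 4 * suc p                  ≤⟨ +-monoˡ-≤ _ (four-mul≤square m q) ⟩
      (m + q) * (m + q) + 4 * suc p            ≤⟨ +-monoˡ-≤ _ (*-mono-≤ m+q≤2p+1 m+q≤2p+1) ⟩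
      K                                        ∎)

  three-halves-bound : ∀ m p q → p + p ≤ m + q → 3 * ((m + p) + (p + q)) < 4 * (m + p + q) + 1
  three-halves-bound m p q 2p≤m+q = subst₂ _<_ (lhs m p q) (rhs m p q) (+-monoˡ-< (3 * m + 4 * p + 3 * q) (s≤s 2p≤m+q))
    where
    lhs : ∀ m p q → p + p + (3 * m + 4 * p + 3 * q) ≡ 3 * ((m + p) + (p + q))
    lhs = solve-∀
    rhs : ∀ m p q → suc (m + q) + (3 * m + 4 * p + 3 * q) ≡ 4 * (m + p + q) + 1
    rhs = solve-∀

open Arithmetic

open import Data.Nat using (ℕ; _≤_; _<_; _∸_; suc; z<s)
open import Data.Integer using (ℤ; +_; _+_; _-_; _*_; -_; +≤+)
open import Data.Integer.Properties using (pos-+; pos-*; +-injective; drop‿+≤+; m-n≡m⊖n; ⊖-≥; +-identityʳ; +-inverseʳ; i-j≡0⇒i≡j; +-mono-≤; +-monoˡ-≤; i≤i+j; module ≤-Reasoning)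
open import Data.Integer.Tactic.RingSolver using (solve-∀)
open import Data.Product using (_×_; _,_)
open import Relation.Binary.PropositionalEquality using (_≡_; refl; sym; trans; cong; cong₂; subst; subst₂; module ≡-Reasoning)
import Data.Nat as N
import Data.Nat.Properties as NP
import Data.Integer as Z

pos-∸ : ∀ {x t} → t ≤ x → + x - + t ≡ + (x ∸ t)
pos-∸ {x} {t} t≤x = trans (m-n≡m⊖n x t) (⊖-≥ t≤x)

pos-pred : ∀ {k} → 0 < k → + (k ∸ 1) ≡ + k - + 1
pos-pred {suc k} _ = sym (pos-∸ (N.s≤s N.z≤n))

pos-*-pred : ∀ k → + (k N.* (k ∸ 1)) ≡ + k * (+ k - + 1)
pos-*-pred 0       = refl
pos-*-pred (suc k) = trans (pos-* (suc k) k) (cong ((+ suc k) *_) (pos-pred z<s))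

pos-+-cancel : ∀ {a b e} → a N.+ b ≡ e → + a ≡ + e - + b
pos-+-cancel {a} {b} refl = trans (add-sub (+ a) (+ b)) (cong (_- + b) (sym (pos-+ a b)))
  where
  add-sub : ∀ x y → x ≡ x + y - y
  add-sub = solve-∀

pos-deficit : ∀ {X d m c} → 0 < c → X N.+ d ≡ m N.* (c ∸ 1) → + X ≡ + m * (+ c - + 1) - + d
pos-deficit {X} {d} {m} {c} c>0 X+d≡ =
  trans (pos-+-cancel X+d≡) (cong (_- + d) (trans (pos-* m (c ∸ 1)) (cong ((+ m) *_) (pos-pred c>0))))

≡-by-difference : ∀ {x y a b : ℤ} → x - y ≡ a - b → a ≡ b → x ≡ y
≡-by-difference {x} {y} {a} eq refl = i-j≡0⇒i≡j x y (trans eq (+-inverseʳ a))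

-- the right-hand side of the bound, with N = n + 1
bound : ℤ → ℤ → ℤ → ℤ → ℤ
bound N C C̄ V = - (+ 3) * ((C + C̄) * (C + C̄)) + (+ 4) * N * (C + C̄) - (C - C̄) * (C - C̄) - (+ 4) * V - (+ 4) * C̄

bound-decompositionℤ : ∀ σ X Y M C C̄ V D₁ D₂ → σ ≡ X - Y + M * C̄ - C * (C - + 1) → X ≡ M * (C - + 1) - D₁ → V ≡ M + Y - D₂
  → bound (M + C̄ + + 1) C C̄ V ≡ + 4 * σ + + 4 * (D₁ + D₂)
bound-decompositionℤ _ _ Y M C C̄ _ D₁ D₂ refl refl refl = expand Y M C C̄ D₁ D₂
  where
  -- bound written out, since the solver does not unfold definitions
  expand : ∀ Y M C C̄ D₁ D₂ →
    - (+ 3) * ((C + C̄) * (C + C̄)) + (+ 4) * (M + C̄ + + 1) * (C + C̄) - (C - C̄) * (C - C̄) - (+ 4) * (M + Y - D₂) - (+ 4) * C̄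
      ≡ + 4 * (M * (C - + 1) - D₁ - Y + M * C̄ - C * (C - + 1)) + + 4 * (D₁ + D₂)
  expand = solve-∀

excess-sum : ∀ {n c c̄ m R R̄ X Y} → m N.+ c̄ ≡ n → R N.+ R̄ N.+ Y N.+ c̄ ≡ X N.+ c̄ N.* n →
  (+ R - + (c N.* (c ∸ 1))) + (+ R̄ - + (c̄ N.* (c̄ ∸ 1))) ≡ + X - + Y + + m * + c̄ - + c * (+ c - + 1)
excess-sum {c = c} {c̄} {m} {R} {R̄} {X} {Y} refl prefixSums = begin
  (+ R - + (c N.* (c ∸ 1))) + (+ R̄ - + (c̄ N.* (c̄ ∸ 1)))
    ≡⟨ cong₂ (λ t t̄ → (+ R - t) + (+ R̄ - t̄)) (pos-*-pred c) (pos-*-pred c̄) ⟩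
  (+ R - + c * (+ c - + 1)) + (+ R̄ - + c̄ * (+ c̄ - + 1))
    ≡⟨ ≡-by-difference (difference (+ R) (+ R̄) (+ Y) (+ c̄) (+ X) (+ m) (+ c)) prefixSumsℤ ⟩
  + X - + Y + + m * + c̄ - + c * (+ c - + 1) ∎
  where
  open ≡-Reasoning
  difference : ∀ R R̄ Y C̄ X M C →
    (R - C * (C - + 1)) + (R̄ - C̄ * (C̄ - + 1)) - (X - Y + M * C̄ - C * (C - + 1)) ≡ (R + R̄ + Y + C̄) - (X + C̄ * (M + C̄))
  difference = solve-∀
  prefixSumsℤ : + R + + R̄ + + Y + + c̄ ≡ + X + + c̄ * (+ m + + c̄)
  prefixSumsℤ = begin
    + R + + R̄ + + Y + + c̄              ≡⟨ cong (λ z → z + + Y + + c̄) (pos-+ R R̄) ⟨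
    + (R N.+ R̄) + + Y + + c̄            ≡⟨ cong (_+ + c̄) (pos-+ (R N.+ R̄) Y) ⟨
    + (R N.+ R̄ N.+ Y) + + c̄            ≡⟨ pos-+ (R N.+ R̄ N.+ Y) c̄ ⟨
    + (R N.+ R̄ N.+ Y N.+ c̄)            ≡⟨ cong +_ prefixSums ⟩
    + (X N.+ c̄ N.* (m N.+ c̄))          ≡⟨ pos-+ X _ ⟩
    + X + + (c̄ N.* (m N.+ c̄))          ≡⟨ cong (λ z → + X + z) (trans (pos-* c̄ _) (cong ((+ c̄) *_) (pos-+ m c̄))) ⟩
    + X + + c̄ * (+ m + + c̄)            ∎

excess-identityℤ : ∀ σ X Y M C C̄ P Q D₁ → σ ≡ X - Y + M * C̄ - C * (C - + 1) → X ≡ M * (C - + 1) - D₁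
  → C ≡ M + P → C̄ ≡ P + Q → σ + D₁ + Y + P * P ≡ M * Q + P
excess-identityℤ _ _ Y M _ _ P Q D₁ refl refl refl refl = expand Y M P Q D₁
  where
  expand : ∀ Y M P Q D₁ → M * (M + P - + 1) - D₁ - Y + M * (P + Q) - (M + P) * (M + P - + 1) + D₁ + Y + P * P ≡ M * Q + P
  expand = solve-∀

-- σ stands for s A + s Ā, and X, Y for the block sums topLeft and bottomRight
module ExcessBounds {n c c̄ m X Y v : ℕ} {σ : ℤ} (m+c̄≡n : m N.+ c̄ ≡ n) (c>0 : 0 < c)
         (σ≡ : σ ≡ + X - + Y + + m * + c̄ - + c * (+ c - + 1)) where

  bound-decomposition : ∀ {d₁ d₂} → X N.+ d₁ ≡ m N.* (c ∸ 1) → v N.+ d₂ ≡ m N.+ Y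
    → bound (+ (n N.+ 1)) (+ c) (+ c̄) (+ v) ≡ + 4 * σ + + 4 * (+ d₁ + + d₂)
  bound-decomposition {d₁} {d₂} X+d₁≡ v+d₂≡ = begin
    bound (+ (n N.+ 1)) (+ c) (+ c̄) (+ v)
      ≡⟨ cong (λ N → bound N (+ c) (+ c̄) (+ v)) N≡ ⟩
    bound (+ m + + c̄ + + 1) (+ c) (+ c̄) (+ v)
      ≡⟨ bound-decompositionℤ σ (+ X) (+ Y) (+ m) (+ c) (+ c̄) (+ v) (+ d₁) (+ d₂) σ≡ (pos-deficit {m = m} c>0 X+d₁≡) vℤ ⟩
    + 4 * σ + + 4 * (+ d₁ + + d₂) ∎
    where
    open ≡-Reasoning
    N≡ : + (n N.+ 1) ≡ + m + + c̄ + + 1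
    N≡ = trans (cong (λ k → + (k N.+ 1)) (sym m+c̄≡n)) (trans (pos-+ (m N.+ c̄) 1) (cong (_+ + 1) (pos-+ m c̄)))
    vℤ : + v ≡ + m + + Y - + d₂
    vℤ = trans (pos-+-cancel v+d₂≡) (cong (_- + d₂) (pos-+ m Y))

  bound-≤ : X ≤ m N.* (c ∸ 1) → v ≤ m N.+ Y → + 4 * σ Z.≤ bound (+ (n N.+ 1)) (+ c) (+ c̄) (+ v)
  bound-≤ X≤ v≤ = subst (+ 4 * σ Z.≤_) (sym (bound-decomposition (NP.m+[n∸m]≡n X≤) (NP.m+[n∸m]≡n v≤)))
    (subst (λ e → + 4 * σ Z.≤ + 4 * σ + e) (trans (pos-* 4 (d₁ N.+ d₂)) (cong ((+ 4) *_) (pos-+ d₁ d₂))) (i≤i+j (+ 4 * σ) _))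
    where
    d₁ d₂ : ℕ
    d₁ = m N.* (c ∸ 1) ∸ X
    d₂ = m N.+ Y ∸ v

  bound-≡ : X ≡ m N.* (c ∸ 1) → v ≡ m N.+ Y → + 4 * σ ≡ bound (+ (n N.+ 1)) (+ c) (+ c̄) (+ v)
  bound-≡ X≡ v≡ = sym (trans (bound-decomposition (trans (NP.+-identityʳ X) X≡) (trans (NP.+-identityʳ v) v≡)) (+-identityʳ _))

  c+c̄-bound : + 1 Z.≤ σ → m ≤ c → c ≤ n → X ≤ m N.* (c ∸ 1) → 3 N.* (c N.+ c̄) < 4 N.* n N.+ 1
  c+c̄-bound σ≥1 m≤c c≤n X≤ = subst₂ (λ a b → 3 N.* a < 4 N.* b N.+ 1) (sym (cong₂ N._+_ c≡ c̄≡)) (sym n≡)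
    (three-halves-bound m p q (twice≤sum m p q 1+p²≤mq+p))
    where
    p q d₁ : ℕ
    p = c ∸ m
    q = n ∸ c
    d₁ = m N.* (c ∸ 1) ∸ X
    c≡ : c ≡ m N.+ p
    c≡ = sym (NP.m+[n∸m]≡n m≤c)
    n≡ : n ≡ m N.+ p N.+ q
    n≡ = trans (sym (NP.m+[n∸m]≡n c≤n)) (cong (N._+ q) c≡)
    c̄≡ : c̄ ≡ p N.+ q
    c̄≡ = NP.+-cancelˡ-≡ m _ _ (trans m+c̄≡n (trans n≡ (NP.+-assoc m p q)))
    identity : σ + + d₁ + + Y + + p * + p ≡ + m * + q + + p
    identity = excess-identityℤ σ (+ X) (+ Y) (+ m) (+ c) (+ c̄) (+ p) (+ q) (+ d₁) σ≡
      (pos-deficit {m = m} c>0 (NP.m+[n∸m]≡n X≤)) (trans (cong +_ c≡) (pos-+ m p)) (trans (cong +_ c̄≡) (pos-+ p q))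
    1+p²≤mq+p : 1 N.+ p N.* p ≤ m N.* q N.+ p
    1+p²≤mq+p = drop‿+≤+ (subst₂ Z._≤_
      (sym (trans (pos-+ 1 (p N.* p)) (cong (λ z → + 1 + z) (pos-* p p))))
      (sym (trans (pos-+ (m N.* q) p) (cong (_+ + p) (pos-* m q))))
      (begin
        + 1 + + p * + p              ≤⟨ +-monoˡ-≤ (+ p * + p) (+-mono-≤ (+-mono-≤ σ≥1 (+≤+ N.z≤n)) (+≤+ N.z≤n)) ⟩
        σ + + d₁ + + Y + + p * + p   ≡⟨ identity ⟩
        + m * + q + + p              ∎))
      where open ≤-Reasoning

t<x⇒1≤x-t : ∀ {x t} → t < x → + 1 Z.≤ + x - + t
t<x⇒1≤x-t t<x = subst (+ 1 Z.≤_) (sym (pos-∸ (NP.<⇒≤ t<x))) (+≤+ (NP.m<n⇒0<n∸m t<x))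

t≤x⇒0≤x-t : ∀ {x t} → t ≤ x → + 0 Z.≤ + x - + t
t≤x⇒0≤x-t t≤x = subst (+ 0 Z.≤_) (sym (pos-∸ t≤x)) (+≤+ N.z≤n)

a≡n-b-1⇒1+a+b≡n : ∀ {a b n} → + a ≡ + n - + b - + 1 → suc (a N.+ b) ≡ n
a≡n-b-1⇒1+a+b≡n {a} {b} {n} a≡ = +-injective (begin
  + suc (a N.+ b)                ≡⟨ trans (pos-+ 1 (a N.+ b)) (cong (λ z → + 1 + z) (pos-+ a b)) ⟩
  + 1 + (+ a + + b)              ≡⟨ cong (λ z → + 1 + (z + + b)) a≡ ⟩
  + 1 + (+ n - + b - + 1 + + b)  ≡⟨ cancel (+ n) (+ b) ⟩
  + n                            ∎)
  where
  open ≡-Reasoning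
  cancel : ∀ x y → + 1 + (x - y - + 1 + y) ≡ x
  cancel = solve-∀

lemma5p1 : (n : ℕ) → 3 N.≤ n → (A : Mat n) → InSStar n A
    → n N.≤ c A N.+ c (bar A)
    → ((+ 4) * (s A + s (bar A)) Z.≤ - (+ 3) * ((+ c A + + c (bar A)) * (+ c A + + c (bar A))) + (+ 4) * + (n N.+ 1) * (+ c A + + c (bar A)) - (+ c A - + c (bar A)) * (+ c A - + c (bar A)) - (+ 4) * + v A - (+ 4) * + c (bar A))
    × (+ v (bar A) ≡ + n - + c A - + 1 → (+ 4) * (s A + s (bar A)) ≡ - (+ 3) * ((+ c A + + c (bar A)) * (+ c A + + c (bar A))) + (+ 4) * + (n N.+ 1) * (+ c A + + c (bar A)) - (+ c A - + c (bar A)) * (+ c A - + c (bar A)) - (+ 4) * + v A - (+ 4) * + c (bar A))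
    × (3 N.* (c A N.+ c (bar A)) N.< 4 N.* n N.+ 1)
lemma5p1 n 3≤n A H n≤c+c̄ =
    bound-≤ (topLeft≤ zeroDiag m≤c) (subst (_≤ m N.+ bottomRight) (sym v≡rowSum) rowSum≤)
  , equality
  , c+c̄-bound σ≥1 m≤c c≤n (topLeft≤ zeroDiag m≤c)
  where
  open InSStar H using (zeroDiag)
  c≤n : c A ≤ n
  c≤n = cUpTo≤ A n
  m : ℕ
  m = n ∸ c (bar A)
  m+c̄≡n : m N.+ c (bar A) ≡ n
  m+c̄≡n = NP.m∸n+n≡m (cUpTo≤ (bar A) n)
  m≤c : m ≤ c A
  m≤c = NP.+-cancelʳ-≤ (c (bar A)) m (c A) (subst (N._≤ c A N.+ c (bar A)) (sym m+c̄≡n) n≤c+c̄)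
  open Blocks A {c A} {c (bar A)} {m} {n ∸ c A} m+c̄≡n (NP.m+[n∸m]≡n c≤n)
  c-excess : c A N.* (c A ∸ 1) < R A (c A)
  c-excess = cUpTo-prefix> A n (firstRow>0 A H (NP.<⇒≤ 3≤n)) (NP.<-≤-trans z<s 3≤n)
  c>0 : 0 < c A
  c>0 = prefix>⇒pos A c-excess
  σ≡ : s A + s (bar A) ≡ + topLeft - + bottomRight + + m * + c (bar A) - + c A * (+ c A - + 1)
  σ≡ = excess-sum {c = c A} {c (bar A)} {m} {R A (c A)} {R (bar A) (c (bar A))} {topLeft} {bottomRight}
         m+c̄≡n (prefixSums zeroDiag)
  σ≥1 : + 1 Z.≤ s A + s (bar A)
  σ≥1 = +-mono-≤ (t<x⇒1≤x-t c-excess) (t≤x⇒0≤x-t (cUpTo-prefix≥ (bar A) n))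
  v≡rowSum : v A ≡ rowSum A (c A)
  v≡rowSum = r≡rowSum A (c A)
  open ExcessBounds {c̄ = c (bar A)} {m} {topLeft} {bottomRight} {v A} m+c̄≡n c>0 σ≡
  equality : + v (bar A) ≡ + n - + c A - + 1 → (+ 4) * (s A + s (bar A)) ≡ bound (+ (n N.+ 1)) (+ c A) (+ c (bar A)) (+ v A)
  equality v̄≡ = bound-≡ topLeft≡ (trans v≡rowSum rowSum≡)
    where
    v̄+c+1≡n : suc (rowSum (bar A) (c (bar A)) N.+ c A) ≡ n
    v̄+c+1≡n = trans (cong (λ x → suc (x N.+ c A)) (sym (r≡rowSum (bar A) (c (bar A))))) (a≡n-b-1⇒1+a+b≡n v̄≡)
    open EqualityCase H m≤c v̄+c+1≡n
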